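{- Let $\Gamma$ and $\Sigma$ be graphs. If one of them is disconnected and the other has a nontrivial automorphism group, then $(\Gamma,\Sigma)$ is unstable.
   Context: Graphs are finite and simple. The direct product $\Gamma\times\Sigma$ has vertex set $V(\Gamma)\times V(\Sigma)$, with $(u,x)\sim(v,y)$ iff $u\sim v$ in $\Gamma$ and $x\sim y$ in $\Sigma$. The pair $(\Gamma,\Sigma)$ is stable if $\mathrm{Aut}(\Gamma\times\Sigma)\cong\mathrm{Aut}(\Gamma)\times\mathrm{Aut}(\Sigma)$, unstable otherwise. -}

module Defs where

open import Level using (0ℓ)
open import Data.Nat using (ℕ; _*_)
open import Data.Bool using (Bool; true; false; _∧_)
open import Data.Fin using (Fin; remQuot)
open import Data.Product using (_×_; _,_; proj₁; proj₂; Σ; ∃)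
open import Relation.Nullary using (¬_)
open import Relation.Binary.PropositionalEquality
open import Algebra.Bundles using (Group)
open import Algebra.Morphism.Structures using (IsGroupIsomorphism)
import Algebra.Construct.DirectProduct as DP

record Graph (n : ℕ) : Set where
  field
    adj    : Fin n → Fin n → Bool
    adj-sym    : ∀ u v → adj u v ≡ adj v u
    adj-irrefl : ∀ u → adj u u ≡ false
open Graph public

-- Direct (tensor / categorical) product.  Vertices Fin (m * n) are identified
-- with Fin m × Fin n via the standard bijection remQuot (Data.Fin).
_×ᵍ_ : ∀ {m n} → Graph m → Graph n → Graph (m * n)
_×ᵍ_ {m} {n} Γ Σ' = record
  { adj    = λ p q → adj Γ (proj₁ (remQuot {m} n p)) (proj₁ (remQuot {m} n q))
                   ∧ adj Σ' (proj₂ (remQuot {m} n p)) (proj₂ (remQuot {m} n q))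
  ; adj-sym    = λ p q → cong₂ _∧_ (adj-sym Γ _ _) (adj-sym Σ' _ _)
  ; adj-irrefl = λ p → subst (λ b → b ∧ _ ≡ false) (sym′ (adj-irrefl Γ _)) refl
  }
  where sym′ = Relation.Binary.PropositionalEquality.sym

record Auto {n : ℕ} (Γ : Graph n) : Set where
  field
    fun       : Fin n → Fin n
    inv       : Fin n → Fin n
    inv-left  : ∀ x → inv (fun x) ≡ x
    inv-right : ∀ x → fun (inv x) ≡ x
    preserves : ∀ u v → adj Γ (fun u) (fun v) ≡ adj Γ u v
open Auto public

module _ {n : ℕ} (Γ : Graph n) where
  private
    _≈_ : Auto Γ → Auto Γ → Set
    f ≈ g = ∀ x → fun f x ≡ fun g x

    idA : Auto Γ
    idA = record { fun = λ x → x ; inv = λ x → x ; inv-left = λ _ → refl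
                 ; inv-right = λ _ → refl ; preserves = λ _ _ → refl }

    _∘A_ : Auto Γ → Auto Γ → Auto Γ
    f ∘A g = record
      { fun = λ x → fun f (fun g x)
      ; inv = λ x → inv g (inv f x)
      ; inv-left = λ x → trans (cong (inv g) (inv-left f (fun g x))) (inv-left g x)
      ; inv-right = λ x → trans (cong (fun f) (inv-right g (inv f x))) (inv-right f x)
      ; preserves = λ u v → trans (preserves f (fun g u) (fun g v)) (preserves g u v)
      }

    invA : Auto Γ → Auto Γ
    invA f = record
      { fun = inv f ; inv = fun f ; inv-left = inv-right f ; inv-right = inv-left f
      ; preserves = λ u v → trans (Relation.Binary.PropositionalEquality.sym
                                    (preserves f (inv f u) (inv f v)))
                                  (cong₂ (adj Γ) (inv-right f u) (inv-right f v))
      }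

  Aut : Group 0ℓ 0ℓ
  Aut = record
    { Carrier = Auto Γ
    ; _≈_ = _≈_
    ; _∙_ = _∘A_
    ; ε = idA
    ; _⁻¹ = invA
    ; isGroup = record
      { isMonoid = record
        { isSemigroup = record
          { isMagma = record
            { isEquivalence = record
              { refl = λ _ → refl
              ; sym = λ p x → Relation.Binary.PropositionalEquality.sym (p x)
              ; trans = λ p q x → trans (p x) (q x) }
            ; ∙-cong = λ {f} {f'} {g} {g'} p q x → trans (cong (fun f) (q x)) (p (fun g' x)) }
          ; assoc = λ _ _ _ _ → refl }
        ; identity = (λ _ _ → refl) , (λ _ _ → refl) }
      ; inverse = (λ f x → inv-left f x) , (λ f x → inv-right f x)
      ; ⁻¹-cong = λ {f} {g} p x → trans (Relation.Binary.PropositionalEquality.sym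
                     (inv-left g (inv f x)))
                     (cong (inv g) (trans (Relation.Binary.PropositionalEquality.sym
                        (p (inv f x))) (inv-right f x))) }
    }

_≅ᴳ_ : Group 0ℓ 0ℓ → Group 0ℓ 0ℓ → Set
G ≅ᴳ H = ∃ λ (h : Group.Carrier G → Group.Carrier H) →
           IsGroupIsomorphism (Group.rawGroup G) (Group.rawGroup H) h

Stable : ∀ {m n} → Graph m → Graph n → Set
Stable Γ Σ' = Aut (Γ ×ᵍ Σ') ≅ᴳ DP.group (Aut Γ) (Aut Σ')

Unstable : ∀ {m n} → Graph m → Graph n → Set
Unstable Γ Σ' = ¬ Stable Γ Σ'

data Reachable {n : ℕ} (Γ : Graph n) : Fin n → Fin n → Set where
  here : ∀ {u} → Reachable Γ u u
  step : ∀ {u w v} → adj Γ u w ≡ true → Reachable Γ w v → Reachable Γ u v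

Connected : ∀ {n} → Graph n → Set
Connected {n} Γ = Fin n × (∀ u v → Reachable Γ u v)

Disconnected : ∀ {n} → Graph n → Set
Disconnected Γ = ¬ Connected Γ

NontrivialAut : ∀ {n} → Graph n → Set
NontrivialAut {n} Γ = Σ (Auto Γ) λ f → ∃ λ (x : Fin n) → ¬ (fun f x ≡ x)

-- If Γ splits into two sides with no edges between them and σ is a nontrivial
-- automorphism of Σ, then applying σ to the Σ-coordinate on one side only is an
-- automorphism of Γ × Σ that is not of the form α × β.  When both graphs have
-- vertices, (α , β) ↦ α × β embeds the finite group Aut Γ × Aut Σ into Aut (Γ × Σ),
-- so this extra automorphism makes Aut (Γ × Σ) strictly larger; when the product
-- has no vertices, Aut (Γ × Σ) is trivial while Aut Γ × Aut Σ is not.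
-- The side of Γ (the vertices reachable from a fixed one) is only decidable under
-- a double negation, which suffices because instability is itself a negation.
module Submission where

open import Defs
open import Level using (0ℓ)
open import Function using (_∘_)
open import Data.Nat using (ℕ; zero; suc; _*_; _^_; _<_; s≤s)
open import Data.Nat.Properties using (n<1+n)
open import Data.Bool using (Bool; true; false; _∧_)
open import Data.Bool.Properties using (∧-comm)
open import Data.Fin using (Fin; zero; suc; combine; remQuot; toℕ; funToFin; finToFun)
open import Data.Fin.Properties
  using (remQuot-combine; combine-remQuot; combine-injectiveˡ; combine-injectiveʳ;
         pigeonhole; ¬∀⟶∃¬; finToFun-funToFin; ¬Fin0)
open import Data.Product using (_×_; _,_; proj₁; proj₂; uncurry; map)
open import Data.Sum using (_⊎_; inj₁; inj₂)
open import Data.Empty using (⊥; ⊥-elim)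
open import Relation.Nullary using (¬_; Dec; yes; no; contradiction)
open import Relation.Nullary.Decidable using (¬¬-excluded-middle)
open import Relation.Binary.PropositionalEquality
open import Algebra.Bundles using (Group)
open import Algebra.Morphism.Structures using (IsGroupIsomorphism)
import Algebra.Construct.DirectProduct as DP

module _ {X : Set} (_≈_ : X → X → Set) where

  injective⇒¬¬surjective : ∀ {K} (code : X → Fin K) → (∀ x y → code x ≡ code y → x ≈ y) →
    (g : X → X) → (∀ x y → g x ≈ g y → x ≈ y) → ∀ e → ¬ (∀ x → ¬ e ≈ g x)
  injective⇒¬¬surjective {K} code code-inj g g-inj e e∉img =
    let i , j , i<j , same = pigeonhole (n<1+n K) (code ∘ orbit ∘ toℕ)
    in orbit-distinct (toℕ i) (toℕ j) i<j (code-inj _ _ same)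
    where
      orbit : ℕ → X
      orbit zero    = e
      orbit (suc i) = g (orbit i)

      orbit-distinct : ∀ i j → i < j → ¬ orbit i ≈ orbit j
      orbit-distinct zero    (suc j) _         = e∉img (orbit j)
      orbit-distinct (suc i) (suc j) (s≤s i<j) = orbit-distinct i j i<j ∘ g-inj _ _

funToFin-injective : ∀ {m n} (f g : Fin m → Fin n) → funToFin f ≡ funToFin g → ∀ x → f x ≡ g x
funToFin-injective f g eq x = begin
  f x                        ≡⟨ finToFun-funToFin f x ⟨
  finToFun (funToFin f) x    ≡⟨ cong (λ c → finToFun c x) eq ⟩
  finToFun (funToFin g) x    ≡⟨ finToFun-funToFin g x ⟩
  g x                        ∎
  where open ≡-Reasoning

autoCode : ∀ {k} {G : Graph k} → Auto G → Fin (k ^ k)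
autoCode = funToFin ∘ fun

autoCode-injective : ∀ {k} {G : Graph k} (f g : Auto G) → autoCode f ≡ autoCode g → Group._≈_ (Aut G) f g
autoCode-injective f g = funToFin-injective (fun f) (fun g)

¬¬-decidable : ∀ k (P : Fin k → Set) → ¬ ¬ (∀ i → Dec (P i))
¬¬-decidable zero    P ¬dec = ¬dec λ ()
¬¬-decidable (suc k) P ¬dec = ¬¬-excluded-middle λ P₀? →
  ¬¬-decidable k (P ∘ suc) λ P₊? → ¬dec λ { zero → P₀? ; (suc i) → P₊? i }

module _ {k} (G : Graph k) where

  reachable-snoc : ∀ {u w v} → Reachable G u w → adj G w v ≡ true → Reachable G u v
  reachable-snoc here       e′ = step e′ here
  reachable-snoc (step e r) e′ = step e (reachable-snoc r e′)

  reachable-sym : ∀ {u v} → Reachable G u v → Reachable G v u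
  reachable-sym here               = here
  reachable-sym (step {u} {w} e r) = reachable-snoc (reachable-sym r) (trans (adj-sym G w u) e)

  reachable-trans : ∀ {u w v} → Reachable G u w → Reachable G w v → Reachable G u v
  reachable-trans here       r′ = r′
  reachable-trans (step e r) r′ = step e (reachable-trans r r′)

  record Separation : Set₁ where
    field
      Side     : Fin k → Set
      side?    : ∀ u → Dec (Side u)
      closed   : ∀ {u v} → adj G u v ≡ true → Side u → Side v
      inside   : Fin k
      inside∈  : Side inside
      outside  : Fin k
      outside∉ : ¬ Side outside

    no-edge-across : ∀ {u v} → Side u → ¬ Side v → adj G u v ≡ false
    no-edge-across {u} {v} u∈ v∉ with adj G u v in e
    ... | true  = contradiction (closed e u∈) v∉
    ... | false = refl

    no-edge-across′ : ∀ {u v} → ¬ Side u → Side v → adj G u v ≡ false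
    no-edge-across′ {u} {v} u∉ v∈ = trans (adj-sym G u v) (no-edge-across v∈ u∉)

  disconnected⇒¬¬separation : Fin k → Disconnected G → ¬ ¬ Separation
  disconnected⇒¬¬separation a dis ¬sep = ¬¬-decidable k (Reachable G a) λ reach? →
    let v , v∉ = ¬∀⟶∃¬ k (Reachable G a) reach? λ all →
                   dis (a , λ u v → reachable-trans (reachable-sym (all u)) (all v))
    in ¬sep record
      { Side = Reachable G a ; side? = reach? ; closed = λ e r → reachable-snoc r e
      ; inside = a ; inside∈ = here ; outside = v ; outside∉ = v∉ }

applyIf : ∀ {A B : Set} → Dec A → (B → B) → B → B
applyIf (yes _) f y = f y
applyIf (no _)  f y = y

module _ {A B : Set} where

  applyIf-yes : (D : Dec A) → A → (f : B → B) → ∀ y → applyIf D f y ≡ f y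
  applyIf-yes (yes _) _ f y = refl
  applyIf-yes (no ¬a) a f y = contradiction a ¬a

  applyIf-no : (D : Dec A) → ¬ A → (f : B → B) → ∀ y → applyIf D f y ≡ y
  applyIf-no (yes a) ¬a f y = contradiction a ¬a
  applyIf-no (no _)  ¬a f y = refl

  applyIf-inverse : (D : Dec A) (f g : B → B) → (∀ y → g (f y) ≡ y) →
                    ∀ y → applyIf D g (applyIf D f y) ≡ y
  applyIf-inverse (yes _) f g g∘f y = g∘f y
  applyIf-inverse (no _)  f g g∘f y = refl

module _ {k} {G : Graph k} (S : Separation G) where
  open Separation S

  twist-preserves : ∀ {B : Set} (R : B → B → Bool) (f : B → B) → (∀ y y′ → R (f y) (f y′) ≡ R y y′) →
    ∀ u u′ y y′ → adj G u u′ ∧ R (applyIf (side? u) f y) (applyIf (side? u′) f y′) ≡ adj G u u′ ∧ R y y′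
  twist-preserves R f f-pres u u′ y y′ with side? u | side? u′
  ... | yes _  | yes _  = cong (adj G u u′ ∧_) (f-pres y y′)
  ... | no _   | no _   = refl
  ... | yes u∈ | no u′∉ rewrite no-edge-across u∈ u′∉ = refl
  ... | no u∉  | yes u′∈ rewrite no-edge-across′ u∉ u′∈ = refl

Aut-of-vertexless : ∀ {k} (G : Graph k) → ¬ Fin k → ∀ f g → Group._≈_ (Aut G) f g
Aut-of-vertexless G no-vertex f g x = ⊥-elim (no-vertex x)

≅ᴳ-preserves-trivial : ∀ {G H : Group 0ℓ 0ℓ} → G ≅ᴳ H →
  (∀ a b → Group._≈_ G a b) → ∀ x y → Group._≈_ H x y
≅ᴳ-preserves-trivial {G} {H} (h , iso) G-trivial x y =
  let a , ha≈x = surjective x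
      b , hb≈y = surjective y
  in H.trans (H.sym (ha≈x (G-trivial b a))) (hb≈y G.refl)
  where
    open IsGroupIsomorphism iso using (surjective)
    module G = Group G
    module H = Group H

module Product {m n} (Γ : Graph m) (Σ : Graph n) where

  Vertex : Set
  Vertex = Fin m × Fin n

  toPair : Fin (m * n) → Vertex
  toPair = remQuot {m} n

  fromPair : Vertex → Fin (m * n)
  fromPair = uncurry combine

  toPair-fromPair : ∀ p → toPair (fromPair p) ≡ p
  toPair-fromPair (u , y) = remQuot-combine u y

  _~_ : Vertex → Vertex → Bool
  (u , y) ~ (u′ , y′) = adj Γ u u′ ∧ adj Σ y y′

  _≈_ : Auto (Γ ×ᵍ Σ) → Auto (Γ ×ᵍ Σ) → Set
  _≈_ = Group._≈_ (Aut (Γ ×ᵍ Σ))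

  _≈×_ : Auto Γ × Auto Σ → Auto Γ × Auto Σ → Set
  _≈×_ = Group._≈_ (DP.group (Aut Γ) (Aut Σ))

  _at_ : Auto (Γ ×ᵍ Σ) → Vertex → Vertex
  e at p = toPair (fun e (fromPair p))

  at-cong : ∀ e e′ → e ≈ e′ → ∀ p → e at p ≡ e′ at p
  at-cong e e′ e≈e′ p = cong toPair (e≈e′ (fromPair p))

  pairAuto : (F F⁻¹ : Vertex → Vertex) → (∀ p → F⁻¹ (F p) ≡ p) → (∀ p → F (F⁻¹ p) ≡ p) →
             (∀ p q → F p ~ F q ≡ p ~ q) → Auto (Γ ×ᵍ Σ)
  pairAuto F F⁻¹ F⁻¹∘F F∘F⁻¹ F-pres = record
    { fun       = fromPair ∘ F ∘ toPair
    ; inv       = fromPair ∘ F⁻¹ ∘ toPair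
    ; inv-left  = cancel F F⁻¹ F⁻¹∘F
    ; inv-right = cancel F⁻¹ F F∘F⁻¹
    ; preserves = λ p q → trans (cong₂ _~_ (toPair-fromPair (F _)) (toPair-fromPair (F _)))
                                (F-pres _ _)
    }
    where
      cancel : ∀ F G → (∀ p → G (F p) ≡ p) →
               ∀ x → fromPair (G (toPair (fromPair (F (toPair x))))) ≡ x
      cancel F G G∘F x = begin
        fromPair (G (toPair (fromPair (F (toPair x)))))
          ≡⟨ cong (fromPair ∘ G) (toPair-fromPair (F (toPair x))) ⟩
        fromPair (G (F (toPair x)))
          ≡⟨ cong fromPair (G∘F (toPair x)) ⟩
        fromPair (toPair x)
          ≡⟨ combine-remQuot {m} n x ⟩
        x ∎
        where open ≡-Reasoning

  -- The left side is  pairAuto F … at p,  whatever the remaining arguments of pairAuto.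
  pairAuto-at : ∀ F p → toPair (fromPair (F (toPair (fromPair p)))) ≡ F p
  pairAuto-at F p =
    trans (toPair-fromPair (F (toPair (fromPair p)))) (cong F (toPair-fromPair p))

  productAuto : Auto Γ → Auto Σ → Auto (Γ ×ᵍ Σ)
  productAuto α β = pairAuto (map (fun α) (fun β)) (map (inv α) (inv β))
    (λ (u , y) → cong₂ _,_ (inv-left α u) (inv-left β y))
    (λ (u , y) → cong₂ _,_ (inv-right α u) (inv-right β y))
    (λ (u , y) (u′ , y′) → cong₂ _∧_ (preserves α u u′) (preserves β y y′))

  productAuto-at : ∀ α β p → productAuto α β at p ≡ map (fun α) (fun β) p
  productAuto-at α β = pairAuto-at (map (fun α) (fun β))

  productAuto-injective : Fin m → Fin n → ∀ {α β α′ β′} →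
    productAuto α β ≈ productAuto α′ β′ → (α , β) ≈× (α′ , β′)
  productAuto-injective u₀ y₀ {α} {β} {α′} {β′} eq =
      (λ u → cong proj₁ (same u y₀)) , (λ y → cong proj₂ (same u₀ y))
    where
      same : ∀ u y → (fun α u , fun β y) ≡ (fun α′ u , fun β′ y)
      same u y = begin
        (fun α u , fun β y)          ≡⟨ productAuto-at α β (u , y) ⟨
        productAuto α β at (u , y)   ≡⟨ at-cong (productAuto α β) (productAuto α′ β′) eq (u , y) ⟩
        productAuto α′ β′ at (u , y) ≡⟨ productAuto-at α′ β′ (u , y) ⟩
        (fun α′ u , fun β′ y)        ∎
        where open ≡-Reasoning

  second-coordinate-varies⇒non-product : ∀ e u u′ y → ¬ proj₂ (e at (u , y)) ≡ proj₂ (e at (u′ , y)) →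
                 ∀ α β → ¬ e ≈ productAuto α β
  second-coordinate-varies⇒non-product e u u′ y differ α β eq = differ (begin
    proj₂ (e at (u , y))                ≡⟨ cong proj₂ (at-cong e (productAuto α β) eq (u , y)) ⟩
    proj₂ (productAuto α β at (u , y))  ≡⟨ cong proj₂ (productAuto-at α β (u , y)) ⟩
    fun β y                             ≡⟨ cong proj₂ (productAuto-at α β (u′ , y)) ⟨
    proj₂ (productAuto α β at (u′ , y)) ≡⟨ cong proj₂ (at-cong e (productAuto α β) eq (u′ , y)) ⟨
    proj₂ (e at (u′ , y))               ∎)
    where open ≡-Reasoning

  first-coordinate-varies⇒non-product : ∀ e x y y′ → ¬ proj₁ (e at (x , y)) ≡ proj₁ (e at (x , y′)) →
                 ∀ α β → ¬ e ≈ productAuto α β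
  first-coordinate-varies⇒non-product e x y y′ differ α β eq = differ (begin
    proj₁ (e at (x , y))                ≡⟨ cong proj₁ (at-cong e (productAuto α β) eq (x , y)) ⟩
    proj₁ (productAuto α β at (x , y))  ≡⟨ cong proj₁ (productAuto-at α β (x , y)) ⟩
    fun α x                             ≡⟨ cong proj₁ (productAuto-at α β (x , y′)) ⟨
    proj₁ (productAuto α β at (x , y′)) ≡⟨ cong proj₁ (at-cong e (productAuto α β) eq (x , y′)) ⟨
    proj₁ (e at (x , y′))               ∎)
    where open ≡-Reasoning

  non-product⇒unstable : Fin m → Fin n → (e : Auto (Γ ×ᵍ Σ)) →
    (∀ α β → ¬ e ≈ productAuto α β) → Unstable Γ Σ
  non-product⇒unstable u₀ y₀ e non-product (h , iso) =
    injective⇒¬¬surjective _≈×_ code code-injective (h ∘ uncurry productAuto)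
      (λ (α , β) (α′ , β′) eq → productAuto-injective u₀ y₀ {α} {β} {α′} {β′} (injective eq))
      (h e) (λ (α , β) eq → non-product α β (injective eq))
    where
      open IsGroupIsomorphism iso using (injective)

      code : Auto Γ × Auto Σ → Fin (m ^ m * n ^ n)
      code (α , β) = combine (autoCode α) (autoCode β)

      code-injective : ∀ x y → code x ≡ code y → x ≈× y
      code-injective (α , β) (α′ , β′) eq =
          autoCode-injective α α′ (combine-injectiveˡ (autoCode α) (autoCode β) (autoCode α′) (autoCode β′) eq)
        , autoCode-injective β β′ (combine-injectiveʳ (autoCode α) (autoCode β) (autoCode α′) (autoCode β′) eq)

  vertexless-stable⇒trivial : ¬ Vertex → Stable Γ Σ → ∀ x y → x ≈× y
  vertexless-stable⇒trivial no-vertex stable =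
    ≅ᴳ-preserves-trivial {Aut (Γ ×ᵍ Σ)} {DP.group (Aut Γ) (Aut Σ)} stable
      (Aut-of-vertexless (Γ ×ᵍ Σ) (no-vertex ∘ toPair))

  vertexless⇒unstable : ¬ Vertex → NontrivialAut Γ ⊎ NontrivialAut Σ → Unstable Γ Σ
  vertexless⇒unstable no-vertex (inj₁ (σ , x , moved)) stable =
    moved (proj₁ (vertexless-stable⇒trivial no-vertex stable (σ , Group.ε (Aut Σ)) (Group.ε (Aut Γ) , Group.ε (Aut Σ))) x)
  vertexless⇒unstable no-vertex (inj₂ (σ , y , moved)) stable =
    moved (proj₂ (vertexless-stable⇒trivial no-vertex stable (Group.ε (Aut Γ) , σ) (Group.ε (Aut Γ) , Group.ε (Aut Σ))) y)

  twistˡ : Separation Γ → Auto Σ → Auto (Γ ×ᵍ Σ)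
  twistˡ S σ = pairAuto
    (λ (u , y) → u , applyIf (side? u) (fun σ) y)
    (λ (u , y) → u , applyIf (side? u) (inv σ) y)
    (λ (u , y) → cong (u ,_) (applyIf-inverse (side? u) (fun σ) (inv σ) (inv-left σ) y))
    (λ (u , y) → cong (u ,_) (applyIf-inverse (side? u) (inv σ) (fun σ) (inv-right σ) y))
    (λ (u , y) (u′ , y′) → twist-preserves S (adj Σ) (fun σ) (preserves σ) u u′ y y′)
    where open Separation S

  twistʳ : Separation Σ → Auto Γ → Auto (Γ ×ᵍ Σ)
  twistʳ S σ = pairAuto
    (λ (x , y) → applyIf (side? y) (fun σ) x , y)
    (λ (x , y) → applyIf (side? y) (inv σ) x , y)
    (λ (x , y) → cong (_, y) (applyIf-inverse (side? y) (fun σ) (inv σ) (inv-left σ) x))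
    (λ (x , y) → cong (_, y) (applyIf-inverse (side? y) (inv σ) (fun σ) (inv-right σ) x))
    (λ (x , y) (x′ , y′) → trans (∧-comm _ (adj Σ y y′))
      (trans (twist-preserves S (adj Γ) (fun σ) (preserves σ) y y′ x x′) (∧-comm (adj Σ y y′) _)))
    where open Separation S

  separationˡ⇒unstable : Separation Γ → NontrivialAut Σ → Unstable Γ Σ
  separationˡ⇒unstable S (σ , y , moved) =
    non-product⇒unstable inside y (twistˡ S σ)
      (second-coordinate-varies⇒non-product (twistˡ S σ) inside outside y λ same → moved (begin
        fun σ y                          ≡⟨ applyIf-yes (side? inside) inside∈ (fun σ) y ⟨
        applyIf (side? inside) (fun σ) y ≡⟨ cong proj₂ (twist-at inside) ⟨
        proj₂ (twistˡ S σ at (inside , y))  ≡⟨ same ⟩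
        proj₂ (twistˡ S σ at (outside , y)) ≡⟨ cong proj₂ (twist-at outside) ⟩
        applyIf (side? outside) (fun σ) y ≡⟨ applyIf-no (side? outside) outside∉ (fun σ) y ⟩
        y                                ∎))
    where
      open Separation S
      open ≡-Reasoning

      twist-at : ∀ u → twistˡ S σ at (u , y) ≡ (u , applyIf (side? u) (fun σ) y)
      twist-at u = pairAuto-at (λ (u , y) → u , applyIf (side? u) (fun σ) y) (u , y)

  separationʳ⇒unstable : Separation Σ → NontrivialAut Γ → Unstable Γ Σ
  separationʳ⇒unstable S (σ , x , moved) =
    non-product⇒unstable x inside (twistʳ S σ)
      (first-coordinate-varies⇒non-product (twistʳ S σ) x inside outside λ same → moved (begin
        fun σ x                          ≡⟨ applyIf-yes (side? inside) inside∈ (fun σ) x ⟨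
        applyIf (side? inside) (fun σ) x ≡⟨ cong proj₁ (twist-at inside) ⟨
        proj₁ (twistʳ S σ at (x , inside))  ≡⟨ same ⟩
        proj₁ (twistʳ S σ at (x , outside)) ≡⟨ cong proj₁ (twist-at outside) ⟩
        applyIf (side? outside) (fun σ) x ≡⟨ applyIf-no (side? outside) outside∉ (fun σ) x ⟩
        x                                ∎))
    where
      open Separation S
      open ≡-Reasoning

      twist-at : ∀ y → twistʳ S σ at (x , y) ≡ (applyIf (side? y) (fun σ) x , y)
      twist-at y = pairAuto-at (λ (x , y) → applyIf (side? y) (fun σ) x , y) (x , y)

open Product

disconnectedˡ⇒unstable : ∀ {m n} (Γ : Graph m) (Σ : Graph n) →
  Disconnected Γ → NontrivialAut Σ → Unstable Γ Σ
disconnectedˡ⇒unstable {zero}  Γ Σ _   σ = vertexless⇒unstable Γ Σ (¬Fin0 ∘ proj₁) (inj₂ σ)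
disconnectedˡ⇒unstable {suc m} Γ Σ dis σ stable =
  disconnected⇒¬¬separation Γ zero dis λ S → separationˡ⇒unstable Γ Σ S σ stable

disconnectedʳ⇒unstable : ∀ {m n} (Γ : Graph m) (Σ : Graph n) →
  Disconnected Σ → NontrivialAut Γ → Unstable Γ Σ
disconnectedʳ⇒unstable {n = zero}  Γ Σ _   σ = vertexless⇒unstable Γ Σ (¬Fin0 ∘ proj₂) (inj₁ σ)
disconnectedʳ⇒unstable {n = suc n} Γ Σ dis σ stable =
  disconnected⇒¬¬separation Σ zero dis λ S → separationʳ⇒unstable Γ Σ S σ stable

lemma3p3 : ∀ {m n} (Γ : Graph m) (Σ : Graph n) →
    (Disconnected Γ × NontrivialAut Σ) ⊎ (Disconnected Σ × NontrivialAut Γ) →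
    Unstable Γ Σ
lemma3p3 Γ Σ (inj₁ (Γ-disconnected , Σ-nontrivial)) = disconnectedˡ⇒unstable Γ Σ Γ-disconnected Σ-nontrivial
lemma3p3 Γ Σ (inj₂ (Σ-disconnected , Γ-nontrivial)) = disconnectedʳ⇒unstable Γ Σ Σ-disconnected Γ-nontrivial
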